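{- Let $k,d\in\mathbb{N}$ with $k\le d$, and define $B\colon\{0,1\}^k\times\{0,1\}^k\to\{0,1\}$ and $\Psi\colon\{0,1\}^k\times\{0,1\}^k\times\{0,1\}\to\{0,1\}$ by \[B(\mathbf{u},\mathbf{v})=\bigwedge_{i=1}^k\lnot(u_i\oplus v_i),\qquad \Psi(\mathbf{u},\mathbf{v},t)=\Big(\bigvee_{i=1}^k(u_i\oplus v_i)\Big)\wedge t.\] Then for any $\Phi\colon\{0,1\}^k\times\{0,1\}^{d-k}\to\{0,1\}$ and any $A\colon\{0,1\}^k\times\{0,1\}^k\to\{0,1\}$, \[P\big(\Phi(\mathbf{u},\mathbf{r})\oplus\Psi(\mathbf{u},\mathbf{v},t)\,\big|\,A(\mathbf{u},\mathbf{v})\big)>\tfrac12\iff P\big(\Phi(\mathbf{u},\mathbf{r})\,\big|\,A(\mathbf{u},\mathbf{v}),B(\mathbf{u},\mathbf{v})\big)>\tfrac12.\]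
   Context: All probabilities are with respect to independent uniformly distributed variables $\mathbf{u},\mathbf{v}\in\{0,1\}^k$, $\mathbf{r}\in\{0,1\}^{d-k}$, $t\in\{0,1\}$; a Boolean expression inside $P(\cdot)$ stands for the event that it equals $1$, and $\oplus$ denotes XOR. -}

module Defs where

open import Data.Bool using (Bool; true; false; _∧_; _∨_; not; _xor_)
open import Data.Nat using (ℕ; zero; suc; _*_; _<_; _∸_)
open import Data.List using (List; []; _∷_; map; cartesianProduct; filterᵇ; length; _++_)
open import Data.Vec using (Vec; []; _∷_; zipWith; foldr′)
open import Data.Product using (_×_; _,_)

Bits : ℕ → Set
Bits n = Vec Bool n

allBits : (n : ℕ) → List (Bits n)
allBits zero = [] ∷ []
allBits (suc n) = map (false ∷_) (allBits n) ++ map (true ∷_) (allBits n)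

⋀ : ∀ {n} → Vec Bool n → Bool
⋀ = foldr′ _∧_ true

⋁ : ∀ {n} → Vec Bool n → Bool
⋁ = foldr′ _∨_ false

B : ∀ {k} → Bits k → Bits k → Bool
B u v = ⋀ (zipWith (λ a b → not (a xor b)) u v)

Ψ : ∀ {k} → Bits k → Bits k → Bool → Bool
Ψ u v t = ⋁ (zipWith _xor_ u v) ∧ t

-- sample space: (u, v, r, t) ∈ {0,1}^k × {0,1}^k × {0,1}^m × {0,1}, uniform
Ω : ℕ → ℕ → Set
Ω k m = Bits k × Bits k × Bits m × Bool

space : (k m : ℕ) → List (Ω k m)
space k m = cartesianProduct (allBits k)
              (cartesianProduct (allBits k)
                (cartesianProduct (allBits m) (true ∷ false ∷ [])))

count : ∀ {k m} → (Ω k m → Bool) → ℕ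
count {k} {m} E = length (filterᵇ E (space k m))

-- P(X | C) > 1/2 under the uniform distribution on Ω k m, i.e.
-- #(X ∧ C) / #C > 1/2, written without division as #C < 2 · #(X ∧ C).
-- (When #C = 0 this is false, i.e. an undefined conditional probability
-- is not > 1/2.)
CondProbGtHalf : ∀ {k m} → (X C : Ω k m → Bool) → Set
CondProbGtHalf X C = count C < 2 * count (λ ω → X ω ∧ C ω)

module Submission where

-- Split the conditioning event A into A ∧ B and A ∧ ¬B. On B the perturbation Ψ
-- vanishes, so Φ ⊕ Ψ agrees with Φ there; on ¬B it equals the fair coin t, which is
-- independent of Φ, so Φ ⊕ t holds on exactly half of A ∧ ¬B, say on q outcomes.
-- Hence #A = #(A ∧ B) + 2q and #((Φ ⊕ Ψ) ∧ A) = #(Φ ∧ A ∧ B) + q, and the two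
-- comparisons with 1/2 differ only by adding 2q to both sides.

open import Defs
open import Data.Bool using (Bool; true; false; _∧_; not; _xor_; T)
open import Data.Bool.Properties using (∧-assoc; ∧-comm; ∧-zeroʳ; xor-identityʳ; not-distribʳ-xor; T?)
open import Data.Nat using (ℕ; suc; _+_; _*_; _<_; _≤_; _∸_)
open import Data.Nat.Properties using (+-suc; +-comm; *-distribˡ-+; +-identityʳ; +-cancelʳ-<; +-monoˡ-<)
open import Data.List using (List; []; _∷_; map; _++_; length; filterᵇ; cartesianProduct)
open import Data.List.Properties using (filter-++; filter-≐; length-++)
open import Data.Vec using ([]; _∷_)
open import Data.Product using (_×_; _,_)
open import Function using (_∘_)
open import Level using (Level)
open import Function.Bundles using (_⇔_; mk⇔)
open import Relation.Binary.PropositionalEquality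
open ≡-Reasoning

private
  variable
    ℓ ℓ′ : Level
    X : Set ℓ
    Y : Set ℓ′

countᵇ : (X → Bool) → List X → ℕ
countᵇ p xs = length (filterᵇ p xs)

countᵇ-cong : ∀ {p q : X → Bool} → p ≗ q → countᵇ p ≗ countᵇ q
countᵇ-cong {p = p} {q = q} p≗q xs =
  cong length (filter-≐ (T? ∘ p) (T? ∘ q) ((λ {x} → subst T (p≗q x)) , (λ {x} → subst T (sym (p≗q x)))) xs)

countᵇ-++ : ∀ (p : X → Bool) xs ys → countᵇ p (xs ++ ys) ≡ countᵇ p xs + countᵇ p ys
countᵇ-++ p xs ys = trans (cong length (filter-++ (T? ∘ p) xs ys)) (length-++ (filterᵇ p xs))

countᵇ-map : ∀ (p : X → Bool) (f : Y → X) xs → countᵇ p (map f xs) ≡ countᵇ (p ∘ f) xs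
countᵇ-map p f [] = refl
countᵇ-map p f (x ∷ xs) with p (f x)
... | true  = cong suc (countᵇ-map p f xs)
... | false = countᵇ-map p f xs

countᵇ-split : ∀ (p q : X → Bool) xs →
  countᵇ p xs ≡ countᵇ (λ x → p x ∧ q x) xs + countᵇ (λ x → p x ∧ not (q x)) xs
countᵇ-split p q [] = refl
countᵇ-split p q (x ∷ xs) with p x | q x
... | true  | true  = cong suc (countᵇ-split p q xs)
... | true  | false = trans (cong suc (countᵇ-split p q xs)) (sym (+-suc _ _))
... | false | _     = countᵇ-split p q xs

countᵇ-cartesianProduct-cong : ∀ (p q : X × Y → Bool) xs ys →
  (∀ x → countᵇ (p ∘ (x ,_)) ys ≡ countᵇ (q ∘ (x ,_)) ys) →
  countᵇ p (cartesianProduct xs ys) ≡ countᵇ q (cartesianProduct xs ys)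
countᵇ-cartesianProduct-cong p q [] ys fibres = refl
countᵇ-cartesianProduct-cong p q (x ∷ xs) ys fibres = begin
  countᵇ p (map (x ,_) ys ++ cartesianProduct xs ys)
    ≡⟨ countᵇ-++ p (map (x ,_) ys) _ ⟩
  countᵇ p (map (x ,_) ys) + countᵇ p (cartesianProduct xs ys)
    ≡⟨ cong₂ _+_ (countᵇ-map p (x ,_) ys) (countᵇ-cartesianProduct-cong p q xs ys fibres) ⟩
  countᵇ (p ∘ (x ,_)) ys + countᵇ q (cartesianProduct xs ys)
    ≡⟨ cong (_+ _) (fibres x) ⟩
  countᵇ (q ∘ (x ,_)) ys + countᵇ q (cartesianProduct xs ys)
    ≡⟨ cong (_+ _) (countᵇ-map q (x ,_) ys) ⟨
  countᵇ q (map (x ,_) ys) + countᵇ q (cartesianProduct xs ys)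
    ≡⟨ countᵇ-++ q (map (x ,_) ys) _ ⟨
  countᵇ q (map (x ,_) ys ++ cartesianProduct xs ys)
    ∎

countᵇ-++-comm : ∀ (p : X → Bool) xs ys → countᵇ p (xs ++ ys) ≡ countᵇ p (ys ++ xs)
countᵇ-++-comm p xs ys =
  trans (countᵇ-++ p xs ys) (trans (+-comm (countᵇ p xs) _) (sym (countᵇ-++ p ys xs)))

countᵇ-∘-not : (p : Bool → Bool) → countᵇ (p ∘ not) (true ∷ false ∷ []) ≡ countᵇ p (true ∷ false ∷ [])
countᵇ-∘-not p = trans (sym (countᵇ-map p not (true ∷ false ∷ []))) (countᵇ-++-comm p (false ∷ []) (true ∷ []))

flip-coin : ∀ {k m} → Ω k m → Ω k m
flip-coin (u , v , r , t) = u , v , r , not t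

count-∘-flip-coin : ∀ {k m} (E : Ω k m → Bool) → count (E ∘ flip-coin) ≡ count E
count-∘-flip-coin {k} {m} E =
  countᵇ-cartesianProduct-cong _ _ (allBits k) _ λ u →
  countᵇ-cartesianProduct-cong _ _ (allBits k) _ λ v →
  countᵇ-cartesianProduct-cong _ _ (allBits m) _ λ r →
  countᵇ-∘-not (λ t → E (u , v , r , t))

count-xor-coin-half : ∀ {k m} (E f : Bits k → Bits k → Bits m → Bool) →
  let E′ : Ω k m → Bool
      E′ = λ { (u , v , r , t) → E u v r }
      Q : Ω k m → Bool
      Q = λ { (u , v , r , t) → E u v r ∧ (f u v r xor t) }
  in count Q + count Q ≡ count E′
count-xor-coin-half {k} {m} E f = sym (begin
  count E′                              ≡⟨ countᵇ-split E′ coin-agrees (space k m) ⟩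
  count Q + count (λ ω → E′ ω ∧ not (coin-agrees ω))
    ≡⟨ cong (count Q +_) (countᵇ-cong disagree≗Q∘flip (space k m)) ⟩
  count Q + count (Q ∘ flip-coin)       ≡⟨ cong (count Q +_) (count-∘-flip-coin Q) ⟩
  count Q + count Q                     ∎)
  where
  E′ Q coin-agrees : Ω k m → Bool
  E′ (u , v , r , t) = E u v r
  coin-agrees (u , v , r , t) = f u v r xor t
  Q ω = E′ ω ∧ coin-agrees ω

  disagree≗Q∘flip : (λ ω → E′ ω ∧ not (coin-agrees ω)) ≗ Q ∘ flip-coin
  disagree≗Q∘flip (u , v , r , t) = cong (E u v r ∧_) (not-distribʳ-xor (f u v r) t)

Ψ≡¬B∧t : ∀ {k} (u v : Bits k) t → Ψ u v t ≡ not (B u v) ∧ t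
Ψ≡¬B∧t [] [] t = refl
Ψ≡¬B∧t (a ∷ u) (b ∷ v) t with a xor b | Ψ≡¬B∧t u v t
... | true  | _  = refl
... | false | eq = eq

xor-¬∧-on : ∀ f a b t → ((f xor (not b ∧ t)) ∧ a) ∧ b ≡ f ∧ (a ∧ b)
xor-¬∧-on f a true  t rewrite xor-identityʳ f = ∧-assoc f a true
xor-¬∧-on f a false t rewrite ∧-zeroʳ a = trans (∧-zeroʳ _) (sym (∧-zeroʳ f))

xor-¬∧-off : ∀ f a b t → ((f xor (not b ∧ t)) ∧ a) ∧ not b ≡ (a ∧ not b) ∧ (f xor t)
xor-¬∧-off f a false t = trans (∧-assoc (f xor t) a true) (∧-comm (f xor t) (a ∧ true))
xor-¬∧-off f a true  t rewrite ∧-zeroʳ a = ∧-zeroʳ _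

m+[n+n]<2*[o+n]⇔m<2*o : ∀ m n o → m + (n + n) < 2 * (o + n) ⇔ m < 2 * o
m+[n+n]<2*[o+n]⇔m<2*o m n o = mk⇔
  (λ lt → +-cancelʳ-< (n + n) m (2 * o) (subst (m + (n + n) <_) 2*[o+n]≡2*o+[n+n] lt))
  (λ lt → subst (m + (n + n) <_) (sym 2*[o+n]≡2*o+[n+n]) (+-monoˡ-< (n + n) lt))
  where
  2*[o+n]≡2*o+[n+n] : 2 * (o + n) ≡ 2 * o + (n + n)
  2*[o+n]≡2*o+[n+n] = trans (*-distribˡ-+ 2 o n) (cong (λ x → 2 * o + (n + x)) (+-identityʳ n))

lemma1 : (k d : ℕ) → k ≤ d →
    (Φ : Bits k → Bits (d ∸ k) → Bool) → (A : Bits k → Bits k → Bool) →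
    CondProbGtHalf {k} {d ∸ k}
        (λ { (u , v , r , t) → Φ u r xor Ψ u v t })
        (λ { (u , v , r , t) → A u v })
      ⇔
    CondProbGtHalf {k} {d ∸ k}
        (λ { (u , v , r , t) → Φ u r })
        (λ { (u , v , r , t) → A u v ∧ B u v })
lemma1 k d _ Φ A =
  subst₂ (λ c x → c < 2 * x ⇔ count AB < 2 * count ΦAB) (sym count-A) (sym count-ΦΨA)
    (m+[n+n]<2*[o+n]⇔m<2*o (count AB) (count Q) (count ΦAB))
  where
  A′ B′ AB ΦAB Q ΦΨA : Ω k (d ∸ k) → Bool
  A′ (u , v , r , t) = A u v
  B′ (u , v , r , t) = B u v
  AB (u , v , r , t) = A u v ∧ B u v
  ΦAB (u , v , r , t) = Φ u r ∧ (A u v ∧ B u v)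
  Q (u , v , r , t) = (A u v ∧ not (B u v)) ∧ (Φ u r xor t)
  ΦΨA (u , v , r , t) = (Φ u r xor Ψ u v t) ∧ A u v

  count-A : count A′ ≡ count AB + (count Q + count Q)
  count-A = trans (countᵇ-split A′ B′ (space k (d ∸ k)))
    (cong (count AB +_) (sym (count-xor-coin-half (λ u v r → A u v ∧ not (B u v)) (λ u v r → Φ u r))))

  on-B : (λ ω → ΦΨA ω ∧ B′ ω) ≗ ΦAB
  on-B (u , v , r , t) rewrite Ψ≡¬B∧t u v t = xor-¬∧-on (Φ u r) (A u v) (B u v) t

  off-B : (λ ω → ΦΨA ω ∧ not (B′ ω)) ≗ Q
  off-B (u , v , r , t) rewrite Ψ≡¬B∧t u v t = xor-¬∧-off (Φ u r) (A u v) (B u v) t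

  count-ΦΨA : count ΦΨA ≡ count ΦAB + count Q
  count-ΦΨA = trans (countᵇ-split ΦΨA B′ (space k (d ∸ k)))
    (cong₂ _+_ (countᵇ-cong on-B (space k (d ∸ k))) (countᵇ-cong off-B (space k (d ∸ k))))
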